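{- Let $\mathcal{L}$ be a finite meet-semilattice with minimal element $\hat{0}$. Then $h_{\hat{0}}$ is a non-zero-divisor in $$B^{\bullet}(\mathcal{L}) = \frac{\mathbb{Z}[h_x]_{x \in \mathcal{L}}}{((h_x - h_{x \wedge y})(h_y - h_{x \wedge y}) : x, y \in \mathcal{L})}.$$
   Context: A finite meet-semilattice is a finite poset in which any two elements $x, y$ have a greatest lower bound $x \wedge y$; it has a minimal element $\hat{0}$. $B^{\bullet}(\mathcal{L})$ is graded with each $h_x$ in degree $1$. -}

module Defs where

open import Data.Nat using (ℕ)
open import Data.Fin using (Fin)
open import Data.Integer as ℤ using (ℤ)
open import Relation.Binary.PropositionalEquality using (_≡_)
open import Relation.Binary.Lattice.Structures using (IsMeetSemilattice)
open import Relation.Binary.Definitions using (Minimum)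
open import Level using (0ℓ)

-- A finite meet-semilattice: carrier Fin n (any finite set is in bijection
-- with some Fin n), a partial order _≤_ (w.r.t. _≡_), a meet _∧_ that is the
-- infimum, and its minimal element 0̂.
record FiniteMeetSemilattice : Set₁ where
  field
    n     : ℕ
    _≤_   : Fin n → Fin n → Set
    _∧_   : Fin n → Fin n → Fin n
    isMeetSemilattice : IsMeetSemilattice _≡_ _≤_ _∧_
    bot   : Fin n
    bot-minimum : Minimum _≤_ bot

data Poly (X : Set) : Set where
  con  : ℤ → Poly X
  h    : X → Poly X
  _⊕_  : Poly X → Poly X → Poly X
  _⊗_  : Poly X → Poly X → Poly X
  ⊖_   : Poly X → Poly X

infixl 6 _⊕_ _⊖'_
infixl 7 _⊗_

_⊖'_ : {X : Set} → Poly X → Poly X → Poly X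
p ⊖' q = p ⊕ (⊖ q)

-- Equality in B(L) = ℤ[h_x] / ((h_x - h_{x∧y})(h_y - h_{x∧y})):
-- the smallest congruence containing the commutative ring axioms, the
-- identification of constants with ℤ, and the defining relations.
module _ (L : FiniteMeetSemilattice) where
  open FiniteMeetSemilattice L

  infix 4 _≈B_
  data _≈B_ : Poly (Fin n) → Poly (Fin n) → Set where
    ≈refl  : ∀ {p} → p ≈B p
    ≈sym   : ∀ {p q} → p ≈B q → q ≈B p
    ≈trans : ∀ {p q r} → p ≈B q → q ≈B r → p ≈B r
    ⊕-cong : ∀ {p p' q q'} → p ≈B p' → q ≈B q' → p ⊕ q ≈B p' ⊕ q'
    ⊗-cong : ∀ {p p' q q'} → p ≈B p' → q ≈B q' → p ⊗ q ≈B p' ⊗ q'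
    ⊖-cong : ∀ {p q} → p ≈B q → ⊖ p ≈B ⊖ q
    ⊕-assoc : ∀ p q r → (p ⊕ q) ⊕ r ≈B p ⊕ (q ⊕ r)
    ⊕-comm  : ∀ p q → p ⊕ q ≈B q ⊕ p
    ⊕-idʳ   : ∀ p → p ⊕ con (ℤ.+ 0) ≈B p
    ⊖-invʳ  : ∀ p → p ⊕ (⊖ p) ≈B con (ℤ.+ 0)
    ⊗-assoc : ∀ p q r → (p ⊗ q) ⊗ r ≈B p ⊗ (q ⊗ r)
    ⊗-comm  : ∀ p q → p ⊗ q ≈B q ⊗ p
    ⊗-idʳ   : ∀ p → p ⊗ con (ℤ.+ 1) ≈B p
    distribʳ : ∀ p q r → p ⊗ (q ⊕ r) ≈B (p ⊗ q) ⊕ (p ⊗ r)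
    con-+ : ∀ a b → con (a ℤ.+ b) ≈B con a ⊕ con b
    con-* : ∀ a b → con (a ℤ.* b) ≈B con a ⊗ con b
    rel : ∀ x y → (h x ⊖' h (x ∧ y)) ⊗ (h y ⊖' h (x ∧ y)) ≈B con (ℤ.+ 0)

{-# OPTIONS --safe #-}
-- The relations (h x − h (x ∧ y)) (h y − h (x ∧ y)) only involve differences of
-- generators, so shifting every generator by the same amount, h x ↦ h x − h a,
-- induces an endomorphism ψ of B(L) with ψ (h a) = 0.  The divided difference
-- Δ p = (p − ψ p) / h a is defined on polynomials by Δ (h x) = 1 and a
-- twisted product rule, and it respects the relations, hence is well defined
-- on B(L).  As Δ (h a ⊗ f) = f, the equation h a ⊗ f = 0 forces f = Δ 0 = 0.
-- Nothing about the semilattice beyond the shape of the relations is used, so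
-- every generator h a, not only h 0̂, is a non-zero-divisor.
module Submission where

open import Defs
open import Data.Integer using (+_)
open import Data.Fin using (Fin)

import Data.Integer as ℤ
import Data.Integer.Properties as ℤ
open import Data.Maybe using (map)
open import Level using (0ℓ)
open import Relation.Binary.Bundles using (Setoid)
open import Relation.Binary.Consequences using (dec⇒weaklyDec)
open import Relation.Binary.PropositionalEquality using (cong)
open import Algebra.Bundles using (CommutativeRing)
import Algebra.Consequences.Setoid as Consequences
import Algebra.Properties.Group as GroupProperties
open import Algebra.Solver.Ring.AlmostCommutativeRing
  using (fromCommutativeRing; _-Raw-AlmostCommutative⟶_)

module _ (L : FiniteMeetSemilattice) where
  open FiniteMeetSemilattice L using (n; _∧_)

  private
    P : Set
    P = Poly (Fin n)

    infix 4 _≈_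
    _≈_ : P → P → Set
    _≈_ = _≈B_ L

    𝟘 𝟙 : P
    𝟘 = con (+ 0)
    𝟙 = con (+ 1)

  B-setoid : Setoid 0ℓ 0ℓ
  B-setoid = record
    { Carrier = P
    ; _≈_ = _≈_
    ; isEquivalence = record { refl = ≈refl ; sym = ≈sym ; trans = ≈trans }
    }

  open Consequences B-setoid using (comm∧idʳ⇒id; comm∧invʳ⇒inv; comm∧distrˡ⇒distr)

  B-commutativeRing : CommutativeRing 0ℓ 0ℓ
  B-commutativeRing = record
    { Carrier = P
    ; _≈_ = _≈_
    ; _+_ = _⊕_
    ; _*_ = _⊗_
    ; -_ = ⊖_
    ; 0# = 𝟘
    ; 1# = 𝟙
    ; isCommutativeRing = record
      { isRing = record
        { +-isAbelianGroup = record
          { isGroup = record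
            { isMonoid = record
              { isSemigroup = record
                { isMagma = record
                  { isEquivalence = Setoid.isEquivalence B-setoid
                  ; ∙-cong = ⊕-cong }
                ; assoc = ⊕-assoc }
              ; identity = comm∧idʳ⇒id ⊕-comm ⊕-idʳ }
            ; inverse = comm∧invʳ⇒inv ⊕-comm ⊖-invʳ
            ; ⁻¹-cong = ⊖-cong }
          ; comm = ⊕-comm }
        ; *-cong = ⊗-cong
        ; *-assoc = ⊗-assoc
        ; *-identity = comm∧idʳ⇒id ⊗-comm ⊗-idʳ
        ; distrib = comm∧distrˡ⇒distr ⊕-cong ⊗-comm distribʳ }
      ; *-comm = ⊗-comm } }

  open CommutativeRing B-commutativeRing using (reflexive; +-group)
  open GroupProperties +-group using (inverseʳ-unique)

  con-neg : ∀ c → con (ℤ.- c) ≈ ⊖ con c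
  con-neg c = inverseʳ-unique (con c) (con (ℤ.- c))
    (≈trans (≈sym (con-+ c (ℤ.- c))) (reflexive (cong con (ℤ.+-inverseʳ c))))

  con-morphism : ℤ.+-*-rawRing -Raw-AlmostCommutative⟶ fromCommutativeRing B-commutativeRing
  con-morphism = record
    { ⟦_⟧ = con
    ; +-homo = con-+
    ; *-homo = con-*
    ; -‿homo = con-neg
    ; 0-homo = ≈refl
    ; 1-homo = ≈refl
    }

  open import Algebra.Solver.Ring ℤ.+-*-rawRing (fromCommutativeRing B-commutativeRing) con-morphism
    (λ c d → map (λ c≡d → reflexive (cong con c≡d)) (dec⇒weaklyDec ℤ._≟_ c d))

  module DividedDifference (a : Fin n) where

    -- With ψ p = p − h a ⊗ Δ p this is Δ (p ⊗ q) = Δ p ⊗ q ⊕ ψ p ⊗ Δ q,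
    -- the expansion of p q − ψ p ψ q = (p − ψ p) q + ψ p (q − ψ q).
    productRule : P → P → P → P → P
    productRule p ∂p q ∂q = ∂p ⊗ q ⊕ (p ⊖' h a ⊗ ∂p) ⊗ ∂q

    Δ : P → P
    Δ (con _) = 𝟘
    Δ (h _)   = 𝟙
    Δ (p ⊕ q) = Δ p ⊕ Δ q
    Δ (⊖ p)   = ⊖ Δ p
    Δ (p ⊗ q) = productRule p (Δ p) q (Δ q)

    productRule-cong : ∀ {p p' ∂p ∂p' q q' ∂q ∂q'} → p ≈ p' → ∂p ≈ ∂p' → q ≈ q' → ∂q ≈ ∂q' →
                       productRule p ∂p q ∂q ≈ productRule p' ∂p' q' ∂q'
    productRule-cong p≈ ∂p≈ q≈ ∂q≈ =
      ⊕-cong (⊗-cong ∂p≈ q≈) (⊗-cong (⊕-cong p≈ (⊖-cong (⊗-cong ≈refl ∂p≈))) ∂q≈)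

    productRule-comm : ∀ p ∂p q ∂q → productRule p ∂p q ∂q ≈ productRule q ∂q p ∂p
    productRule-comm = solve 5 (λ t p ∂p q ∂q →
      ∂p :* q :+ (p :- t :* ∂p) :* ∂q := ∂q :* p :+ (q :- t :* ∂q) :* ∂p) ≈refl (h a)

    productRule-assoc : ∀ p ∂p q ∂q r ∂r →
      productRule (p ⊗ q) (productRule p ∂p q ∂q) r ∂r ≈ productRule p ∂p (q ⊗ r) (productRule q ∂q r ∂r)
    productRule-assoc = solve 7 (λ t p ∂p q ∂q r ∂r →
      (∂p :* q :+ (p :- t :* ∂p) :* ∂q) :* r :+ (p :* q :- t :* (∂p :* q :+ (p :- t :* ∂p) :* ∂q)) :* ∂r
      := ∂p :* (q :* r) :+ (p :- t :* ∂p) :* (∂q :* r :+ (q :- t :* ∂q) :* ∂r)) ≈refl (h a)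

    productRule-distrib : ∀ p ∂p q ∂q r ∂r →
      productRule p ∂p (q ⊕ r) (∂q ⊕ ∂r) ≈ productRule p ∂p q ∂q ⊕ productRule p ∂p r ∂r
    productRule-distrib = solve 7 (λ t p ∂p q ∂q r ∂r →
      ∂p :* (q :+ r) :+ (p :- t :* ∂p) :* (∂q :+ ∂r)
      := (∂p :* q :+ (p :- t :* ∂p) :* ∂q) :+ (∂p :* r :+ (p :- t :* ∂p) :* ∂r)) ≈refl (h a)

    productRule-identity : ∀ p ∂p → productRule p ∂p 𝟙 𝟘 ≈ ∂p
    productRule-identity = solve 3 (λ t p ∂p →
      ∂p :* con (+ 1) :+ (p :- t :* ∂p) :* con (+ 0) := ∂p) ≈refl (h a)

    productRule-constant : ∀ p q → productRule p 𝟘 q 𝟘 ≈ 𝟘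
    productRule-constant = solve 3 (λ t p q →
      con (+ 0) :* q :+ (p :- t :* con (+ 0)) :* con (+ 0) := con (+ 0)) ≈refl (h a)

    productRule-differences : ∀ p q → productRule p (𝟙 ⊖' 𝟙) q (𝟙 ⊖' 𝟙) ≈ 𝟘
    productRule-differences = solve 3 (λ t p q →
      (con (+ 1) :- con (+ 1)) :* q :+ (p :- t :* (con (+ 1) :- con (+ 1))) :* (con (+ 1) :- con (+ 1))
      := con (+ 0)) ≈refl (h a)

    productRule-h : ∀ f ∂f → productRule (h a) 𝟙 f ∂f ≈ f
    productRule-h = solve 3 (λ t f ∂f →
      con (+ 1) :* f :+ (t :- t :* con (+ 1)) :* ∂f := f) ≈refl (h a)

    Δ-cong : ∀ {p q} → p ≈ q → Δ p ≈ Δ q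
    Δ-cong ≈refl              = ≈refl
    Δ-cong (≈sym e)           = ≈sym (Δ-cong e)
    Δ-cong (≈trans e e')      = ≈trans (Δ-cong e) (Δ-cong e')
    Δ-cong (⊕-cong e e')      = ⊕-cong (Δ-cong e) (Δ-cong e')
    Δ-cong (⊗-cong e e')      = productRule-cong e (Δ-cong e) e' (Δ-cong e')
    Δ-cong (⊖-cong e)         = ⊖-cong (Δ-cong e)
    Δ-cong (⊕-assoc p q r)    = ⊕-assoc (Δ p) (Δ q) (Δ r)
    Δ-cong (⊕-comm p q)       = ⊕-comm (Δ p) (Δ q)
    Δ-cong (⊕-idʳ p)          = ⊕-idʳ (Δ p)
    Δ-cong (⊖-invʳ p)         = ⊖-invʳ (Δ p)
    Δ-cong (⊗-assoc p q r)    = productRule-assoc p (Δ p) q (Δ q) r (Δ r)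
    Δ-cong (⊗-comm p q)       = productRule-comm p (Δ p) q (Δ q)
    Δ-cong (⊗-idʳ p)          = productRule-identity p (Δ p)
    Δ-cong (distribʳ p q r)   = productRule-distrib p (Δ p) q (Δ q) r (Δ r)
    Δ-cong (con-+ _ _)        = ≈sym (⊕-idʳ 𝟘)
    Δ-cong (con-* c d)        = ≈sym (productRule-constant (con c) (con d))
    Δ-cong (rel x y)          = productRule-differences (h x ⊖' h (x ∧ y)) (h y ⊖' h (x ∧ y))

    Δ-h⊗ : ∀ f → Δ (h a ⊗ f) ≈ f
    Δ-h⊗ f = productRule-h f (Δ f)

  h-nonZeroDivisor : ∀ a f → h a ⊗ f ≈ 𝟘 → f ≈ 𝟘
  h-nonZeroDivisor a f h⊗f≈𝟘 = ≈trans (≈sym (Δ-h⊗ f)) (Δ-cong h⊗f≈𝟘)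
    where open DividedDifference a

lemma4p3 : (L : FiniteMeetSemilattice) (f : Poly (Fin (FiniteMeetSemilattice.n L)))
    → _≈B_ L (h (FiniteMeetSemilattice.bot L) ⊗ f) (con (+ 0))
    → _≈B_ L f (con (+ 0))
lemma4p3 L = h-nonZeroDivisor L (FiniteMeetSemilattice.bot L)
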